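{- Let $X$ and $Y$ be finite nonempty sets, $F: X\to 2^Y$ a set-valued mapping, and let $(W_1,\ldots,W_m)$ and $(W'_1,\ldots,W'_{m'})$ be Hall partitions of $F$. Then $m = m'$ and there is a permutation $i_1,\ldots,i_m$ of $1,\ldots,m$ such that $W'_j = W_{i_j}$ for $j=1,\ldots,m$.
   Context: A set-valued mapping $F: X \to 2^Y$ assigns to each $x$ a (possibly empty) subset $F(x) \subset Y$; $F(W) = \bigcup_{x\in W}F(x)$; $\sharp$ is cardinality. For $W \subset X$, $F_W: X\setminus W \to 2^Y$ is $F_W(x) = F(x) \setminus F(W)$. For set-valued $G$ on a finite set, a subset $W$ of its domain is critical for $G$ if $W\ne\emptyset$ and $\sharp G(W)=\sharp W$; non-reducible for $G$ if $W\ne\emptyset$ and no proper subset of $W$ is critical for $G$. A tuple $(W_1,\ldots,W_m)$, $m\ge1$, is a Hall partition of $F$ if the $W_i$ are nonempty, pairwise disjoint with union $X$, and with $G_i = F_{W_1\cup\cdots\cup W_{i-1}}$ ($G_1=F$): (i) $G_i(x)\neq\emptyset$ for $x \in W_i$, all $i$; (ii) $W_i$ is non-reducible for $G_i$, all $i$; (iii) $W_i$ is critical for $G_i$ for $i \le m-1$. -}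

module Defs where

open import Data.Nat using (ℕ; zero; suc)
open import Data.Bool using (true; false)
open import Data.Fin using (Fin)
import Data.Fin as Fin
open import Data.Fin.Subset
open import Data.Vec using ([]; _∷_)
open import Data.List using (List; []; _∷_)
open import Data.Product using (_×_)
open import Data.Empty renaming (⊥ to False)
open import Relation.Nullary using (¬_)
open import Relation.Binary.PropositionalEquality using (_≡_)

SetValued : ℕ → ℕ → Set
SetValued n k = Fin n → Subset k

image : ∀ {n k} → SetValued n k → Subset n → Subset k
image {zero}  F []            = ⊥
image {suc n} F (true  ∷ W)   = F Fin.zero ∪ image (λ x → F (Fin.suc x)) W
image {suc n} F (false ∷ W)   = image (λ x → F (Fin.suc x)) W

-- The mapping G = F_U : X \ U → 2^Y, G(x) = F(x) \ F(U).  We keep the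
-- ambient type Fin n and only apply G to points/subsets of X \ U; note
-- G(W) = F(W) \ F(U).
restrict : ∀ {n k} → SetValued n k → Subset n → SetValued n k
restrict F U x = F x ─ image F U

Critical : ∀ {n k} → SetValued n k → Subset n → Set
Critical G W = Nonempty W × ∣ image G W ∣ ≡ ∣ W ∣

NonReducible : ∀ {n k} → SetValued n k → Subset n → Set
NonReducible G W = Nonempty W × (∀ V → V ⊂ W → ¬ Critical G V)

BlockOK : ∀ {n k} → SetValued n k → Subset n → Subset n → Set
BlockOK F U W =
  (∀ x → x ∈ W → Nonempty (restrict F U x))
  × NonReducible (restrict F U) W

-- HallFrom F U (W_i ∷ … ∷ W_m): the remaining blocks, given that
-- U = W_1 ∪ … ∪ W_{i-1} has already been used.  Each block is disjoint
-- from all previous ones (so the blocks are pairwise disjoint), the last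
-- block completes the union to X, and (iii) holds for all but the last.
HallFrom : ∀ {n k} → SetValued n k → Subset n → List (Subset n) → Set
HallFrom F U []             = False
HallFrom F U (W ∷ [])       =
  (W ∩ U ≡ ⊥) × BlockOK F U W × (U ∪ W ≡ ⊤)
HallFrom F U (W ∷ W′ ∷ Ws)  =
  (W ∩ U ≡ ⊥) × BlockOK F U W × Critical (restrict F U) W
  × HallFrom F (U ∪ W) (W′ ∷ Ws)

HallPartition : ∀ {n k} → SetValued n k → List (Subset n) → Set
HallPartition F Ws = HallFrom F ⊥ Ws

-- Write c(S) = ♯F(S), a submodular function.  Since F(A ∪ B) is the disjoint union of
-- F(A) and F_A(B), a Hall partition forces Hall's condition ♯S ≤ c(S) block by block.
-- Under Hall's condition the tight sets (c(S) ≤ ♯S) are closed under union and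
-- intersection, and each union W₁ ∪ … ∪ Wᵢ with i < m is tight.  If a block V of one
-- partition, with predecessors A, meets a tight set Z, then A ∪ (V ∩ Z) is tight, which
-- makes V ∩ Z critical for F_A; non-reducibility of V then forces V ⊆ Z.  Walking along
-- the other partition, V therefore lies in its first block W that V meets; by symmetry
-- W lies in a block of the first partition, which can only be V.  Hence both lists
-- contain the same blocks, each exactly once.
module Submission where

open import Data.Bool using (true; false)
open import Data.Empty using (⊥-elim)
import Data.Fin as Fin
open import Data.Fin.Subset
open import Data.Fin.Subset.Properties
open import Data.Fin.Subset.Induction using (Acc; acc; ⊂-wellFounded)
open import Data.List using (List; []; _∷_)
open import Data.List.Membership.Propositional using () renaming (_∈_ to _∈ₗ_)
open import Data.List.Membership.Propositional.Properties.WithK using (unique∧set⇒bag)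
open import Data.List.Relation.Binary.BagAndSetEquality using (∼bag⇒↭)
open import Data.List.Relation.Binary.Permutation.Propositional using (_↭_)
open import Data.List.Relation.Unary.All using (tabulate)
open import Data.List.Relation.Unary.AllPairs using ([]; _∷_)
open import Data.List.Relation.Unary.Any using (here; there)
open import Data.List.Relation.Unary.Unique.Propositional using (Unique)
open import Data.Nat using (ℕ; zero; suc; _+_; _≤_; z≤n; s≤s)
open import Data.Nat.Properties
open import Data.Product using (_×_; _,_; proj₁; proj₂; ∃)
open import Data.Sum using (_⊎_; inj₁; inj₂; [_,_]′; map₂)
open import Data.Vec using ([]; _∷_; here; there)
open import Function using (_∘_)
open import Function.Bundles using (mk⇔)
open import Relation.Binary.PropositionalEquality
open import Relation.Nullary using (Dec; yes; no; ¬_)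

open import Defs

private
  variable
    n k : ℕ

∩≡⊥⇒∉ : ∀ {p q : Subset n} {x} → p ∩ q ≡ ⊥ → x ∈ p → x ∉ q
∩≡⊥⇒∉ {x = x} disj x∈p x∈q = ∉⊥ (subst (x ∈_) disj (x∈p∩q⁺ (x∈p , x∈q)))

∉⇒∩≡⊥ : ∀ {p q : Subset n} → (∀ {x} → x ∈ p → x ∉ q) → p ∩ q ≡ ⊥
∉⇒∩≡⊥ {p = p} {q} disj = Empty-unique λ (_ , x∈p∩q) →
  let x∈p , x∈q = x∈p∩q⁻ p q x∈p∩q in disj x∈p x∈q

x∈p─q⁻ : ∀ (p q : Subset n) {x} → x ∈ p ─ q → x ∈ p × x ∉ q
x∈p─q⁻ (true  ∷ p) (false ∷ q) here = here , λ ()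
x∈p─q⁻ (true  ∷ p) (true  ∷ q) {Fin.zero} ()
x∈p─q⁻ (false ∷ p) (true  ∷ q) {Fin.zero} ()
x∈p─q⁻ (false ∷ p) (false ∷ q) {Fin.zero} ()
x∈p─q⁻ (_ ∷ p) (_ ∷ q) (there x∈p─q) =
  let x∈p , x∉q = x∈p─q⁻ p q x∈p─q in there x∈p , x∉q ∘ drop-there

p⊆q∪r⇒p⊆r : ∀ {p q r : Subset n} → p ∩ q ≡ ⊥ → p ⊆ q ∪ r → p ⊆ r
p⊆q∪r⇒p⊆r {q = q} {r} disj p⊆q∪r x∈p with x∈p∪q⁻ q r (p⊆q∪r x∈p)
... | inj₁ x∈q = ⊥-elim (∩≡⊥⇒∉ disj x∈p x∈q)
... | inj₂ x∈r = x∈r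

p∩q∪p─q≡p : ∀ (p q : Subset n) → (p ∩ q) ∪ (p ─ q) ≡ p
p∩q∪p─q≡p []          []          = refl
p∩q∪p─q≡p (true  ∷ p) (true  ∷ q) = cong (true ∷_) (p∩q∪p─q≡p p q)
p∩q∪p─q≡p (true  ∷ p) (false ∷ q) = cong (true ∷_) (p∩q∪p─q≡p p q)
p∩q∪p─q≡p (false ∷ p) (true  ∷ q) = cong (false ∷_) (p∩q∪p─q≡p p q)
p∩q∪p─q≡p (false ∷ p) (false ∷ q) = cong (false ∷_) (p∩q∪p─q≡p p q)

∣p∪q∣+∣p∩q∣≡∣p∣+∣q∣ : ∀ (p q : Subset n) → ∣ p ∪ q ∣ + ∣ p ∩ q ∣ ≡ ∣ p ∣ + ∣ q ∣
∣p∪q∣+∣p∩q∣≡∣p∣+∣q∣ []          []          = refl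
∣p∪q∣+∣p∩q∣≡∣p∣+∣q∣ (true  ∷ p) (true  ∷ q) =
  cong suc (trans (+-suc _ _) (trans (cong suc (∣p∪q∣+∣p∩q∣≡∣p∣+∣q∣ p q)) (sym (+-suc _ _))))
∣p∪q∣+∣p∩q∣≡∣p∣+∣q∣ (true  ∷ p) (false ∷ q) = cong suc (∣p∪q∣+∣p∩q∣≡∣p∣+∣q∣ p q)
∣p∪q∣+∣p∩q∣≡∣p∣+∣q∣ (false ∷ p) (true  ∷ q) =
  trans (cong suc (∣p∪q∣+∣p∩q∣≡∣p∣+∣q∣ p q)) (sym (+-suc _ _))
∣p∪q∣+∣p∩q∣≡∣p∣+∣q∣ (false ∷ p) (false ∷ q) = ∣p∪q∣+∣p∩q∣≡∣p∣+∣q∣ p q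

∣p∪q∣≡∣p∣+∣q─p∣ : ∀ (p q : Subset n) → ∣ p ∪ q ∣ ≡ ∣ p ∣ + ∣ q ─ p ∣
∣p∪q∣≡∣p∣+∣q─p∣ []          []          = refl
∣p∪q∣≡∣p∣+∣q─p∣ (true  ∷ p) (true  ∷ q) = cong suc (∣p∪q∣≡∣p∣+∣q─p∣ p q)
∣p∪q∣≡∣p∣+∣q─p∣ (true  ∷ p) (false ∷ q) = cong suc (∣p∪q∣≡∣p∣+∣q─p∣ p q)
∣p∪q∣≡∣p∣+∣q─p∣ (false ∷ p) (true  ∷ q) = trans (cong suc (∣p∪q∣≡∣p∣+∣q─p∣ p q)) (sym (+-suc _ _))
∣p∪q∣≡∣p∣+∣q─p∣ (false ∷ p) (false ∷ q) = ∣p∪q∣≡∣p∣+∣q─p∣ p q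

∣p∣≡∣p∩q∣+∣p─q∣ : ∀ (p q : Subset n) → ∣ p ∣ ≡ ∣ p ∩ q ∣ + ∣ p ─ q ∣
∣p∣≡∣p∩q∣+∣p─q∣ []          []          = refl
∣p∣≡∣p∩q∣+∣p─q∣ (true  ∷ p) (true  ∷ q) = cong suc (∣p∣≡∣p∩q∣+∣p─q∣ p q)
∣p∣≡∣p∩q∣+∣p─q∣ (true  ∷ p) (false ∷ q) = trans (cong suc (∣p∣≡∣p∩q∣+∣p─q∣ p q)) (sym (+-suc _ _))
∣p∣≡∣p∩q∣+∣p─q∣ (false ∷ p) (true  ∷ q) = ∣p∣≡∣p∩q∣+∣p─q∣ p q
∣p∣≡∣p∩q∣+∣p─q∣ (false ∷ p) (false ∷ q) = ∣p∣≡∣p∩q∣+∣p─q∣ p q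

∣p∪q∣≡∣p∣+∣q∣ : ∀ (p q : Subset n) → q ∩ p ≡ ⊥ → ∣ p ∪ q ∣ ≡ ∣ p ∣ + ∣ q ∣
∣p∪q∣≡∣p∣+∣q∣ {n} p q disj = begin
  ∣ p ∪ q ∣             ≡⟨ +-identityʳ _ ⟨
  ∣ p ∪ q ∣ + 0         ≡⟨ cong (∣ p ∪ q ∣ +_) (∣⊥∣≡0 n) ⟨
  ∣ p ∪ q ∣ + ∣ ⊥ {n} ∣ ≡⟨ cong (λ s → ∣ p ∪ q ∣ + ∣ s ∣) (trans (∩-comm p q) disj) ⟨
  ∣ p ∪ q ∣ + ∣ p ∩ q ∣ ≡⟨ ∣p∪q∣+∣p∩q∣≡∣p∣+∣q∣ p q ⟩
  ∣ p ∣ + ∣ q ∣         ∎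
  where open ≡-Reasoning

∣p∣≤1+∣p-x∣ : ∀ (p : Subset n) x → ∣ p ∣ ≤ suc ∣ p - x ∣
∣p∣≤1+∣p-x∣ p x = begin
  ∣ p ∣                     ≡⟨ ∣p∣≡∣p∩q∣+∣p─q∣ p ⁅ x ⁆ ⟩
  ∣ p ∩ ⁅ x ⁆ ∣ + ∣ p - x ∣ ≤⟨ +-monoˡ-≤ ∣ p - x ∣ (∣p∩q∣≤∣q∣ p ⁅ x ⁆) ⟩
  ∣ ⁅ x ⁆ ∣ + ∣ p - x ∣     ≡⟨ cong (_+ ∣ p - x ∣) (∣⁅x⁆∣≡1 x) ⟩
  suc ∣ p - x ∣             ∎
  where open ≤-Reasoning

nonempty⇒1≤∣p∣ : ∀ {p : Subset n} → Nonempty p → 1 ≤ ∣ p ∣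
nonempty⇒1≤∣p∣ (_ , x∈p) = ≤-trans (s≤s z≤n) (x∈p⇒∣p-x∣<∣p∣ x∈p)

image⁺ : ∀ (F : SetValued n k) {A x y} → x ∈ A → y ∈ F x → y ∈ image F A
image⁺ F {true  ∷ A} here        y∈Fx = x∈p∪q⁺ (inj₁ y∈Fx)
image⁺ F {true  ∷ A} (there x∈A) y∈Fx = x∈p∪q⁺ (inj₂ (image⁺ (F ∘ Fin.suc) x∈A y∈Fx))
image⁺ F {false ∷ A} (there x∈A) y∈Fx = image⁺ (F ∘ Fin.suc) x∈A y∈Fx

image⁻ : ∀ (F : SetValued n k) A {y} → y ∈ image F A → ∃ λ x → x ∈ A × y ∈ F x
image⁻ {zero}  F []          y∈ = ⊥-elim (∉⊥ y∈)
image⁻ {suc n} F (true  ∷ A) y∈ with x∈p∪q⁻ (F Fin.zero) (image (F ∘ Fin.suc) A) y∈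
... | inj₁ y∈F0 = Fin.zero , here , y∈F0
... | inj₂ y∈FA = let x , x∈A , y∈Fx = image⁻ (F ∘ Fin.suc) A y∈FA in Fin.suc x , there x∈A , y∈Fx
image⁻ {suc n} F (false ∷ A) y∈ =
  let x , x∈A , y∈Fx = image⁻ (F ∘ Fin.suc) A y∈ in Fin.suc x , there x∈A , y∈Fx

image-mono : ∀ {G H : SetValued n k} {A B} → (∀ x → G x ⊆ H x) → A ⊆ B → image G A ⊆ image H B
image-mono {G = G} {H} {A} G⊆H A⊆B y∈ =
  let x , x∈A , y∈Gx = image⁻ G A y∈ in image⁺ H (A⊆B x∈A) (G⊆H x y∈Gx)

image-monoʳ : ∀ (F : SetValued n k) {A B} → A ⊆ B → image F A ⊆ image F B
image-monoʳ F = image-mono (λ _ → ⊆-refl)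

image-⊥ : ∀ (F : SetValued n k) → image F ⊥ ≡ ⊥
image-⊥ F = Empty-unique λ (_ , y∈) → ∉⊥ (proj₁ (proj₂ (image⁻ F ⊥ y∈)))

image-∪ : ∀ (F : SetValued n k) A B → image F (A ∪ B) ≡ image F A ∪ image F B
image-∪ F A B = ⊆-antisym split join
  where
  split : image F (A ∪ B) ⊆ image F A ∪ image F B
  split y∈ with image⁻ F (A ∪ B) y∈
  ... | x , x∈A∪B , y∈Fx with x∈p∪q⁻ A B x∈A∪B
  ...   | inj₁ x∈A = x∈p∪q⁺ (inj₁ (image⁺ F x∈A y∈Fx))
  ...   | inj₂ x∈B = x∈p∪q⁺ (inj₂ (image⁺ F x∈B y∈Fx))
  join : image F A ∪ image F B ⊆ image F (A ∪ B)
  join y∈ with x∈p∪q⁻ (image F A) (image F B) y∈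
  ... | inj₁ y∈FA = image-monoʳ F (p⊆p∪q B) y∈FA
  ... | inj₂ y∈FB = image-monoʳ F (q⊆p∪q A B) y∈FB

image-restrict : ∀ (F : SetValued n k) U V → image (restrict F U) V ≡ image F V ─ image F U
image-restrict F U V = ⊆-antisym to from
  where
  to : image (restrict F U) V ⊆ image F V ─ image F U
  to y∈ with image⁻ (restrict F U) V y∈
  ... | x , x∈V , y∈Gx with x∈p─q⁻ (F x) (image F U) y∈Gx
  ...   | y∈Fx , y∉FU = x∈p∧x∉q⇒x∈p─q (image⁺ F x∈V y∈Fx) y∉FU
  from : image F V ─ image F U ⊆ image (restrict F U) V
  from y∈ with x∈p─q⁻ (image F V) (image F U) y∈
  ... | y∈FV , y∉FU with image⁻ F V y∈FV
  ...   | x , x∈V , y∈Fx = image⁺ (restrict F U) x∈V (x∈p∧x∉q⇒x∈p─q y∈Fx y∉FU)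

restrict-⊥ : ∀ (F : SetValued n k) S → image (restrict F ⊥) S ≡ image F S
restrict-⊥ F S = begin
  image (restrict F ⊥) S    ≡⟨ image-restrict F ⊥ S ⟩
  image F S ─ image F ⊥     ≡⟨ cong (image F S ─_) (image-⊥ F) ⟩
  image F S ─ ⊥             ≡⟨ p─⊥≡p (image F S) ⟩
  image F S                 ∎
  where open ≡-Reasoning

restrict-antitone : ∀ (F : SetValued n k) {U U′} S → U ⊆ U′ →
  ∣ image (restrict F U′) S ∣ ≤ ∣ image (restrict F U) S ∣
restrict-antitone F {U} {U′} _ U⊆U′ = p⊆q⇒∣p∣≤∣q∣ (image-mono shrink ⊆-refl)
  where
  shrink : ∀ x → restrict F U′ x ⊆ restrict F U x
  shrink x y∈ with x∈p─q⁻ (F x) (image F U′) y∈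
  ... | y∈Fx , y∉FU′ = x∈p∧x∉q⇒x∈p─q y∈Fx (y∉FU′ ∘ image-monoʳ F U⊆U′)

∣image-∪∣ : ∀ (F : SetValued n k) A B →
  ∣ image F (A ∪ B) ∣ ≡ ∣ image F A ∣ + ∣ image (restrict F A) B ∣
∣image-∪∣ F A B = begin
  ∣ image F (A ∪ B) ∣                       ≡⟨ cong ∣_∣ (image-∪ F A B) ⟩
  ∣ image F A ∪ image F B ∣                 ≡⟨ ∣p∪q∣≡∣p∣+∣q─p∣ (image F A) (image F B) ⟩
  ∣ image F A ∣ + ∣ image F B ─ image F A ∣ ≡⟨ cong ((∣ image F A ∣ +_) ∘ ∣_∣) (image-restrict F A B) ⟨
  ∣ image F A ∣ + ∣ image (restrict F A) B ∣ ∎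
  where open ≡-Reasoning

∣image-restrict-∪∣ : ∀ (F : SetValued n k) U A B →
  ∣ image (restrict F U) (A ∪ B) ∣ ≡ ∣ image (restrict F U) A ∣ + ∣ image (restrict F (U ∪ A)) B ∣
∣image-restrict-∪∣ F U A B = +-cancelˡ-≡ ∣ image F U ∣ _ _ (begin
  ∣ image F U ∣ + ∣ image (restrict F U) (A ∪ B) ∣ ≡⟨ ∣image-∪∣ F U (A ∪ B) ⟨
  ∣ image F (U ∪ (A ∪ B)) ∣                        ≡⟨ cong (∣_∣ ∘ image F) (∪-assoc U A B) ⟨
  ∣ image F ((U ∪ A) ∪ B) ∣                        ≡⟨ ∣image-∪∣ F (U ∪ A) B ⟩
  ∣ image F (U ∪ A) ∣ + ∣ image (restrict F (U ∪ A)) B ∣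
    ≡⟨ cong (_+ ∣ image (restrict F (U ∪ A)) B ∣) (∣image-∪∣ F U A) ⟩
  (∣ image F U ∣ + ∣ image (restrict F U) A ∣) + ∣ image (restrict F (U ∪ A)) B ∣
    ≡⟨ +-assoc ∣ image F U ∣ _ _ ⟩
  ∣ image F U ∣ + (∣ image (restrict F U) A ∣ + ∣ image (restrict F (U ∪ A)) B ∣) ∎)
  where open ≡-Reasoning

image-submodular : ∀ (F : SetValued n k) S Z →
  ∣ image F (S ∪ Z) ∣ + ∣ image F (S ∩ Z) ∣ ≤ ∣ image F S ∣ + ∣ image F Z ∣
image-submodular F S Z = begin
  ∣ image F (S ∪ Z) ∣ + ∣ image F (S ∩ Z) ∣
    ≡⟨ cong ((_+ ∣ image F (S ∩ Z) ∣) ∘ ∣_∣) (image-∪ F S Z) ⟩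
  ∣ image F S ∪ image F Z ∣ + ∣ image F (S ∩ Z) ∣
    ≤⟨ +-monoʳ-≤ ∣ image F S ∪ image F Z ∣ (p⊆q⇒∣p∣≤∣q∣ meet) ⟩
  ∣ image F S ∪ image F Z ∣ + ∣ image F S ∩ image F Z ∣
    ≡⟨ ∣p∪q∣+∣p∩q∣≡∣p∣+∣q∣ (image F S) (image F Z) ⟩
  ∣ image F S ∣ + ∣ image F Z ∣ ∎
  where
  open ≤-Reasoning
  meet : image F (S ∩ Z) ⊆ image F S ∩ image F Z
  meet y∈ = x∈p∩q⁺ (image-monoʳ F (p∩q⊆p S Z) y∈ , image-monoʳ F (p∩q⊆q S Z) y∈)

Hall : SetValued n k → Set
Hall F = ∀ S → ∣ S ∣ ≤ ∣ image F S ∣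

Tight : SetValued n k → Subset n → Set
Tight F S = ∣ image F S ∣ ≤ ∣ S ∣

module _ {F : SetValued n k} (hall : Hall F) {S Z : Subset n} (tight-S : Tight F S) (tight-Z : Tight F Z) where
  open ≤-Reasoning

  private
    modular-bound : ∣ image F (S ∪ Z) ∣ + ∣ image F (S ∩ Z) ∣ ≤ ∣ S ∪ Z ∣ + ∣ S ∩ Z ∣
    modular-bound = begin
      ∣ image F (S ∪ Z) ∣ + ∣ image F (S ∩ Z) ∣ ≤⟨ image-submodular F S Z ⟩
      ∣ image F S ∣ + ∣ image F Z ∣             ≤⟨ +-mono-≤ tight-S tight-Z ⟩
      ∣ S ∣ + ∣ Z ∣                             ≡⟨ ∣p∪q∣+∣p∩q∣≡∣p∣+∣q∣ S Z ⟨
      ∣ S ∪ Z ∣ + ∣ S ∩ Z ∣                     ∎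

  tight-∪ : Tight F (S ∪ Z)
  tight-∪ = +-cancelʳ-≤ ∣ image F (S ∩ Z) ∣ _ _ (begin
    ∣ image F (S ∪ Z) ∣ + ∣ image F (S ∩ Z) ∣ ≤⟨ modular-bound ⟩
    ∣ S ∪ Z ∣ + ∣ S ∩ Z ∣                     ≤⟨ +-monoʳ-≤ ∣ S ∪ Z ∣ (hall (S ∩ Z)) ⟩
    ∣ S ∪ Z ∣ + ∣ image F (S ∩ Z) ∣           ∎)

  tight-∩ : Tight F (S ∩ Z)
  tight-∩ = +-cancelˡ-≤ ∣ image F (S ∪ Z) ∣ _ _ (begin
    ∣ image F (S ∪ Z) ∣ + ∣ image F (S ∩ Z) ∣ ≤⟨ modular-bound ⟩
    ∣ S ∪ Z ∣ + ∣ S ∩ Z ∣                     ≤⟨ +-monoˡ-≤ ∣ S ∩ Z ∣ (hall (S ∪ Z)) ⟩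
    ∣ image F (S ∪ Z) ∣ + ∣ S ∩ Z ∣           ∎)

tight-⊥ : ∀ (F : SetValued n k) → Tight F ⊥
tight-⊥ {n} {k} F = ≤-reflexive (begin
  ∣ image F ⊥ ∣  ≡⟨ cong ∣_∣ (image-⊥ F) ⟩
  ∣ ⊥ {k} ∣      ≡⟨ ∣⊥∣≡0 k ⟩
  0              ≡⟨ ∣⊥∣≡0 n ⟨
  ∣ ⊥ {n} ∣      ∎)
  where open ≡-Reasoning

restrict-≤⇒tight-∪ : ∀ {F : SetValued n k} {U W} → Tight F U → W ∩ U ≡ ⊥ →
  ∣ image (restrict F U) W ∣ ≤ ∣ W ∣ → Tight F (U ∪ W)
restrict-≤⇒tight-∪ {F = F} {U} {W} tight-U disj restricted = begin
  ∣ image F (U ∪ W) ∣                        ≡⟨ ∣image-∪∣ F U W ⟩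
  ∣ image F U ∣ + ∣ image (restrict F U) W ∣ ≤⟨ +-mono-≤ tight-U restricted ⟩
  ∣ U ∣ + ∣ W ∣                              ≡⟨ ∣p∪q∣≡∣p∣+∣q∣ U W disj ⟨
  ∣ U ∪ W ∣                                  ∎
  where open ≤-Reasoning

tight-∪⇒restrict-≤ : ∀ {F : SetValued n k} {U W} → Hall F → W ∩ U ≡ ⊥ → Tight F (U ∪ W) →
  ∣ image (restrict F U) W ∣ ≤ ∣ W ∣
tight-∪⇒restrict-≤ {F = F} {U} {W} hall disj tight-U∪W = +-cancelˡ-≤ ∣ U ∣ _ _ (begin
  ∣ U ∣ + ∣ image (restrict F U) W ∣           ≤⟨ +-monoˡ-≤ _ (hall U) ⟩
  ∣ image F U ∣ + ∣ image (restrict F U) W ∣   ≡⟨ ∣image-∪∣ F U W ⟨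
  ∣ image F (U ∪ W) ∣                          ≤⟨ tight-U∪W ⟩
  ∣ U ∪ W ∣                                    ≡⟨ ∣p∪q∣≡∣p∣+∣q∣ U W disj ⟩
  ∣ U ∣ + ∣ W ∣                                ∎)
  where open ≤-Reasoning

nonReducible⇒hall : ∀ {G : SetValued n k} {W} → (∀ x → x ∈ W → Nonempty (G x)) → NonReducible G W →
  ∀ V → V ⊆ W → ∣ V ∣ ≤ ∣ image G V ∣
nonReducible⇒hall {n} {G = G} {W} nonempty-values (_ , no-proper-critical) V = go V (⊂-wellFounded V)
  where
  go : ∀ V → Acc _⊂_ V → V ⊆ W → ∣ V ∣ ≤ ∣ image G V ∣
  go V (acc smaller) V⊆W with nonempty? V
  ... | no V-empty = ≤-trans (≤-reflexive (trans (cong ∣_∣ (Empty-unique V-empty)) (∣⊥∣≡0 n))) z≤n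
  ... | yes (x , x∈V) with ∣ V ∣ ≤? ∣ image G V ∣
  ...   | yes enough = enough
  ...   | no deficient with nonempty? (V - x)
  ...     | yes V-x-nonempty = ⊥-elim (no-proper-critical (V - x) V-x⊂W (V-x-nonempty , V-x-tight))
    where
    V-x⊂V : V - x ⊂ V
    V-x⊂V = x∈p⇒p-x⊂p x∈V
    V-x⊂W : V - x ⊂ W
    V-x⊂W = ⊂-⊆-trans V-x⊂V V⊆W
    V-x-tight : ∣ image G (V - x) ∣ ≡ ∣ V - x ∣
    V-x-tight = ≤-antisym
      (≤-trans (p⊆q⇒∣p∣≤∣q∣ (image-monoʳ G (proj₁ V-x⊂V)))
               (≤-pred (≤-trans (≰⇒> deficient) (∣p∣≤1+∣p-x∣ V x))))
      (go (V - x) (smaller V-x⊂V) (proj₁ V-x⊂W))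
  ...     | no V-x-empty = ⊥-elim (deficient (begin
    ∣ V ∣              ≤⟨ ∣p∣≤1+∣p-x∣ V x ⟩
    suc ∣ V - x ∣      ≡⟨ cong (suc ∘ ∣_∣) (Empty-unique V-x-empty) ⟩
    suc ∣ ⊥ {n} ∣      ≡⟨ cong suc (∣⊥∣≡0 n) ⟩
    1                  ≤⟨ nonempty⇒1≤∣p∣ (nonempty-values x (V⊆W x∈V)) ⟩
    ∣ G x ∣            ≤⟨ p⊆q⇒∣p∣≤∣q∣ (image⁺ G x∈V) ⟩
    ∣ image G V ∣      ∎))
    where open ≤-Reasoning

critical⇒tight-∪ : ∀ {F : SetValued n k} {U W} → Tight F U → W ∩ U ≡ ⊥ →
  Critical (restrict F U) W → Tight F (U ∪ W)
critical⇒tight-∪ tight-U disj (_ , critical) = restrict-≤⇒tight-∪ tight-U disj (≤-reflexive critical)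

hallFrom⇒hall : ∀ {F : SetValued n k} {U} Ws → HallFrom F U Ws →
  ∀ S → S ∩ U ≡ ⊥ → ∣ S ∣ ≤ ∣ image (restrict F U) S ∣
hallFrom⇒hall (W ∷ []) (_ , (nonempty-values , nonReducible) , covers) S disj =
  nonReducible⇒hall nonempty-values nonReducible S (p⊆q∪r⇒p⊆r disj (subst (S ⊆_) (sym covers) ⊆⊤))
hallFrom⇒hall {F = F} {U} (W ∷ W′ ∷ Ws) (_ , (nonempty-values , nonReducible) , _ , rest) S disj =
  begin
  ∣ S ∣                                               ≡⟨ ∣p∣≡∣p∩q∣+∣p─q∣ S W ⟩
  ∣ S ∩ W ∣ + ∣ S ─ W ∣
    ≤⟨ +-monoʳ-≤ ∣ S ∩ W ∣ (hallFrom⇒hall (W′ ∷ Ws) rest (S ─ W) S─W-disjoint) ⟩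
  ∣ S ∩ W ∣ + ∣ image (restrict F (U ∪ W)) (S ─ W) ∣
    ≤⟨ +-mono-≤ within-W (restrict-antitone F (S ─ W) U∪S∩W⊆U∪W) ⟩
  ∣ image (restrict F U) (S ∩ W) ∣ + ∣ image (restrict F (U ∪ (S ∩ W))) (S ─ W) ∣
    ≡⟨ ∣image-restrict-∪∣ F U (S ∩ W) (S ─ W) ⟨
  ∣ image (restrict F U) ((S ∩ W) ∪ (S ─ W)) ∣        ≡⟨ cong (∣_∣ ∘ image (restrict F U)) (p∩q∪p─q≡p S W) ⟩
  ∣ image (restrict F U) S ∣                          ∎
  where
  open ≤-Reasoning
  within-W : ∣ S ∩ W ∣ ≤ ∣ image (restrict F U) (S ∩ W) ∣
  within-W = nonReducible⇒hall nonempty-values nonReducible (S ∩ W) (p∩q⊆q S W)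
  S─W-disjoint : (S ─ W) ∩ (U ∪ W) ≡ ⊥
  S─W-disjoint = ∉⇒∩≡⊥ λ x∈S─W x∈U∪W →
    let x∈S , x∉W = x∈p─q⁻ S W x∈S─W in
    [ ∩≡⊥⇒∉ disj x∈S , x∉W ]′ (x∈p∪q⁻ U W x∈U∪W)
  U∪S∩W⊆U∪W : U ∪ (S ∩ W) ⊆ U ∪ W
  U∪S∩W⊆U∪W x∈ = x∈p∪q⁺ (map₂ (p∩q⊆q S W) (x∈p∪q⁻ U (S ∩ W) x∈))

hallPartition⇒hall : ∀ {F : SetValued n k} Ws → HallPartition F Ws → Hall F
hallPartition⇒hall {F = F} Ws partition S =
  subst (∣ S ∣ ≤_) (cong ∣_∣ (restrict-⊥ F S)) (hallFrom⇒hall Ws partition S (∩-zeroʳ S))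

-- V is a block of a Hall chain and A is the union of the blocks preceding it.
record HallBlock (F : SetValued n k) (A V : Subset n) : Set where
  field
    disjoint     : V ∩ A ≡ ⊥
    admissible   : BlockOK F A V
    tight-before : Tight F A
    tight-after  : Tight F (A ∪ V) ⊎ A ∪ V ≡ ⊤

  nonempty-values : ∀ x → x ∈ V → Nonempty (restrict F A x)
  nonempty-values = proj₁ admissible

  nonReducible : NonReducible (restrict F A) V
  nonReducible = proj₂ admissible

  nonempty : Nonempty V
  nonempty = proj₁ nonReducible

  no-proper-critical : ∀ T → T ⊂ V → ¬ Critical (restrict F A) T
  no-proper-critical = proj₂ nonReducible

hallFrom⇒hallBlock : ∀ {F : SetValued n k} {U} Ws → HallFrom F U Ws → Tight F U →
  ∀ {V} → V ∈ₗ Ws → ∃ λ A → HallBlock F A V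
hallFrom⇒hallBlock {U = U} (W ∷ []) (disj , ok , covers) tight-U (here refl) =
  U , record { disjoint = disj ; admissible = ok ; tight-before = tight-U ; tight-after = inj₂ covers }
hallFrom⇒hallBlock {U = U} (W ∷ _ ∷ _) (disj , ok , crit , _) tight-U (here refl) =
  U , record { disjoint = disj ; admissible = ok ; tight-before = tight-U
             ; tight-after = inj₁ (critical⇒tight-∪ tight-U disj crit) }
hallFrom⇒hallBlock (W ∷ Ws@(_ ∷ _)) (disj , _ , crit , rest) tight-U (there V∈Ws) =
  hallFrom⇒hallBlock Ws rest (critical⇒tight-∪ tight-U disj crit) V∈Ws

tight-∩-or-full : ∀ {F : SetValued n k} {S Z} → Hall F → Tight F S ⊎ S ≡ ⊤ → Tight F Z → Tight F (S ∩ Z)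
tight-∩-or-full hall (inj₁ tight-S) tight-Z = tight-∩ hall tight-S tight-Z
tight-∩-or-full {Z = Z} hall (inj₂ refl) tight-Z = subst (Tight _) (sym (∩-identityˡ Z)) tight-Z

hallBlock-⊆-tight : ∀ {F : SetValued n k} {A V Z} → Hall F → HallBlock F A V → Tight F Z →
  Nonempty (V ∩ Z) → V ⊆ Z
hallBlock-⊆-tight {F = F} {A} {V} {Z} hall block tight-Z meets {x} x∈V with x ∈? Z
... | yes x∈Z = x∈Z
... | no x∉Z = ⊥-elim (no-proper-critical (V ∩ Z) V∩Z⊂V (meets , V∩Z-critical))
  where
  open HallBlock block
  V∩Z⊂V : V ∩ Z ⊂ V
  V∩Z⊂V = p∩q⊆p V Z , x , x∈V , x∉Z ∘ p∩q⊆q V Z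
  V∩Z-disjoint : (V ∩ Z) ∩ A ≡ ⊥
  V∩Z-disjoint = ∉⇒∩≡⊥ λ y∈V∩Z → ∩≡⊥⇒∉ disjoint (p∩q⊆p V Z y∈V∩Z)
  A∪V∩Z-tight : Tight F (A ∪ (V ∩ Z))
  A∪V∩Z-tight = subst (Tight F) (sym (∪-distribˡ-∩ A V Z))
    (tight-∩-or-full hall tight-after (tight-∪ hall tight-before tight-Z))
  V∩Z-critical : ∣ image (restrict F A) (V ∩ Z) ∣ ≡ ∣ V ∩ Z ∣
  V∩Z-critical = ≤-antisym (tight-∪⇒restrict-≤ hall V∩Z-disjoint A∪V∩Z-tight)
    (nonReducible⇒hall nonempty-values nonReducible (V ∩ Z) (p∩q⊆p V Z))

hallBlock-⊆-block : ∀ {F : SetValued n k} {A V U} → Hall F → HallBlock F A V →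
  ∀ Ws → HallFrom F U Ws → Tight F U → V ∩ U ≡ ⊥ → ∃ λ W → W ∈ₗ Ws × V ⊆ W
hallBlock-⊆-block {V = V} hall block (W ∷ []) (_ , _ , covers) _ disj =
  W , here refl , p⊆q∪r⇒p⊆r disj (subst (V ⊆_) (sym covers) ⊆⊤)
hallBlock-⊆-block {F = F} {V = V} {U} hall block (W ∷ W′ ∷ Ws) (W-disj , _ , crit , rest) tight-U disj =
  first-meeting (nonempty? (V ∩ (U ∪ W)))
    (λ misses → hallBlock-⊆-block hall block (W′ ∷ Ws) rest tight-U∪W (Empty-unique misses))
  where
  tight-U∪W : Tight F (U ∪ W)
  tight-U∪W = critical⇒tight-∪ tight-U W-disj crit
  first-meeting : Dec (Nonempty (V ∩ (U ∪ W))) →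
    (Empty (V ∩ (U ∪ W)) → ∃ λ X → X ∈ₗ W′ ∷ Ws × V ⊆ X) → ∃ λ X → X ∈ₗ W ∷ W′ ∷ Ws × V ⊆ X
  first-meeting (yes meets) _ = W , here refl , p⊆q∪r⇒p⊆r disj (hallBlock-⊆-tight hall block tight-U∪W meets)
  first-meeting (no misses) later = let X , X∈Ws , V⊆X = later misses in X , there X∈Ws , V⊆X

hallFrom-disjoint : ∀ {F : SetValued n k} {U} Ws → HallFrom F U Ws → ∀ {X} → X ∈ₗ Ws → X ∩ U ≡ ⊥
hallFrom-disjoint (W ∷ [])    (disj , _) (here refl) = disj
hallFrom-disjoint (W ∷ _ ∷ _) (disj , _) (here refl) = disj
hallFrom-disjoint {U = U} (W ∷ Ws@(_ ∷ _)) (_ , _ , _ , rest) (there X∈Ws) =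
  ∉⇒∩≡⊥ λ x∈X x∈U → ∩≡⊥⇒∉ (hallFrom-disjoint Ws rest X∈Ws) x∈X (x∈p∪q⁺ (inj₁ x∈U))

hallFrom-meet⇒≡ : ∀ {F : SetValued n k} {U} Ws → HallFrom F U Ws → ∀ {X Y x} → X ∈ₗ Ws → Y ∈ₗ Ws →
  x ∈ X → x ∈ Y → X ≡ Y
hallFrom-meet⇒≡ (W ∷ [])    _ (here refl) (here refl) _ _ = refl
hallFrom-meet⇒≡ (W ∷ _ ∷ _) _ (here refl) (here refl) _ _ = refl
hallFrom-meet⇒≡ (W ∷ Ws@(_ ∷ _)) (_ , _ , _ , rest) (here refl) (there Y∈Ws) x∈W x∈Y =
  ⊥-elim (∩≡⊥⇒∉ (hallFrom-disjoint Ws rest Y∈Ws) x∈Y (x∈p∪q⁺ (inj₂ x∈W)))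
hallFrom-meet⇒≡ (W ∷ Ws@(_ ∷ _)) (_ , _ , _ , rest) (there X∈Ws) (here refl) x∈X x∈W =
  ⊥-elim (∩≡⊥⇒∉ (hallFrom-disjoint Ws rest X∈Ws) x∈X (x∈p∪q⁺ (inj₂ x∈W)))
hallFrom-meet⇒≡ (W ∷ Ws@(_ ∷ _)) (_ , _ , _ , rest) (there X∈Ws) (there Y∈Ws) =
  hallFrom-meet⇒≡ Ws rest X∈Ws Y∈Ws

hallFrom-unique : ∀ {F : SetValued n k} {U} Ws → HallFrom F U Ws → Unique Ws
hallFrom-unique (W ∷ [])    _ = tabulate (λ ()) ∷ []
hallFrom-unique (W ∷ Ws@(_ ∷ _)) (_ , (_ , (x , x∈W) , _) , _ , rest) =
  tabulate W≢ ∷ hallFrom-unique Ws rest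
  where
  W≢ : ∀ {X} → X ∈ₗ Ws → W ≢ X
  W≢ X∈Ws refl = ∩≡⊥⇒∉ (hallFrom-disjoint Ws rest X∈Ws) x∈W (x∈p∪q⁺ (inj₂ x∈W))

hallPartition-block⇒block : ∀ {F : SetValued n k} Ws Ws′ → HallPartition F Ws → HallPartition F Ws′ →
  ∀ {V} → V ∈ₗ Ws′ → V ∈ₗ Ws
hallPartition-block⇒block {F = F} Ws Ws′ partition partition′ {V} V∈Ws′ =
  let _ , V-block         = hallFrom⇒hallBlock Ws′ partition′ (tight-⊥ F) V∈Ws′
      W , W∈Ws , V⊆W      = hallBlock-⊆-block hall V-block Ws partition (tight-⊥ F) (∩-zeroʳ V)
      _ , W-block         = hallFrom⇒hallBlock Ws partition (tight-⊥ F) W∈Ws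
      V′ , V′∈Ws′ , W⊆V′ = hallBlock-⊆-block hall W-block Ws′ partition′ (tight-⊥ F) (∩-zeroʳ W)
      x , x∈V             = HallBlock.nonempty V-block
      V≡V′                = hallFrom-meet⇒≡ Ws′ partition′ V∈Ws′ V′∈Ws′ x∈V (W⊆V′ (V⊆W x∈V))
  in subst (_∈ₗ Ws) (⊆-antisym (subst (W ⊆_) (sym V≡V′) W⊆V′) V⊆W) W∈Ws
  where
  hall : Hall F
  hall = hallPartition⇒hall Ws partition

theorem6p1 : ∀ {n k} (F : SetValued (suc n) (suc k)) (Ws Ws′ : List (Subset (suc n))) →
    HallPartition F Ws → HallPartition F Ws′ → Ws ↭ Ws′
theorem6p1 F Ws Ws′ partition partition′ =
  ∼bag⇒↭ (unique∧set⇒bag (hallFrom-unique Ws partition) (hallFrom-unique Ws′ partition′)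
    (mk⇔ (hallPartition-block⇒block Ws′ Ws partition′ partition)
         (hallPartition-block⇒block Ws Ws′ partition partition′)))
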